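{- Let $a,b$ be integers with $a > b \ge 0$, let $T = \{x+yi \in \mathbb{Z}[i] : 0 \le x < b,\ -b \le y < 0\}$ and $S = \{x+yi \in \mathbb{Z}[i] : 0 \le x,y < a\}$. Then $S\cup T$ contains exactly one representative of each residue class of $\mathbb{Z}[i]$ modulo $a+bi$. -}

module Defs where

open import Data.Integer using (ℤ; _+_; _*_; _-_; -_; _≤_; _<_; 0ℤ)
open import Data.Product using (_×_; _,_; ∃)
open import Data.Sum using (_⊎_)
open import Relation.Binary.PropositionalEquality using (_≡_)

record ℤ[i] : Set where
  constructor _+_i
  field
    re : ℤ
    im : ℤ
open ℤ[i] public

infixl 6 _+ᵍ_ _-ᵍ_
infixl 7 _*ᵍ_

_+ᵍ_ : ℤ[i] → ℤ[i] → ℤ[i]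
(x + y i) +ᵍ (u + v i) = (x + u) + (y + v) i

_-ᵍ_ : ℤ[i] → ℤ[i] → ℤ[i]
(x + y i) -ᵍ (u + v i) = (x - u) + (y - v) i

_*ᵍ_ : ℤ[i] → ℤ[i] → ℤ[i]
(x + y i) *ᵍ (u + v i) = (x * u - y * v) + (x * v + y * u) i

_∣ᵍ_ : ℤ[i] → ℤ[i] → Set
m ∣ᵍ z = ∃ λ q → z ≡ q *ᵍ m

_≡_[modᵍ_] : ℤ[i] → ℤ[i] → ℤ[i] → Set
z ≡ w [modᵍ m ] = m ∣ᵍ (z -ᵍ w)

InT : ℤ → ℤ[i] → Set
InT b (x + y i) = (0ℤ ≤ x × x < b) × (- b ≤ y × y < 0ℤ)

InS : ℤ → ℤ[i] → Set
InS a (x + y i) = (0ℤ ≤ x × x < a) × (0ℤ ≤ y × y < a)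

InS∪T : ℤ → ℤ → ℤ[i] → Set
InS∪T a b z = InS a z ⊎ InT b z

-- Write m = a + b i; its multiples form the lattice spanned by m = (a , b) and
-- i m = (- b , a). Translating the L-shaped tile S ∪ T by the multiples of m gives a
-- staircase band whose floor over the column 0 ≤ x < a is y = - b for x < b and y = 0
-- for x ≥ b, and whose ceiling is y = a; its translate by i m sits exactly on top of it.
-- Existence: reduce the real part modulo a (with m) and the imaginary part modulo
-- a² + b² (with (b + a i) m = (a² + b²) i), which puts the point in the column above the
-- floor, then walk down the staircase by - i m, adding - m whenever the walk leaves the
-- column, until the point is below the ceiling.
-- Uniqueness: let w - w′ = (s + t i) m with (s , t) lexicographically positive. If s > 0
-- and t ≤ 0 the real parts differ by at least a; if s , t > 0 the imaginary parts differ
-- by at least a + b; if s = 0 < t then w′ lies below the real axis, hence in T, and then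
-- w lies left of the imaginary axis. Neither is possible for two points of the tile.

module Submission where

open import Defs
open import Data.Integer using (ℤ; _≤_; _<_; 0ℤ)
open import Data.Product using (_×_; _,_; ∃)
open import Relation.Binary.PropositionalEquality using (_≡_)

open import Data.Empty using (⊥; ⊥-elim)
open import Data.Integer.Base
  using (+_; _+_; _-_; -_; _*_; 1ℤ; -1ℤ; +0; +[1+_]; +≤+; +<+; NonNegative; nonNegative)
open import Data.Integer.DivMod using (_/ℕ_; _%ℕ_; a≡a%ℕn+[a/ℕn]*n; n%ℕd<d)
import Data.Integer.Properties as ℤ
open import Data.Integer.Tactic.RingSolver using (solve; solve-∀)
open import Data.List.Base using (_∷_; [])
open import Data.Nat.Base using (ℕ; zero; suc; z≤n)
open import Data.Product using (∃₂; proj₁; proj₂)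
open import Data.Sum using (_⊎_; inj₁; inj₂)
open import Relation.Binary.Definitions using (tri<; tri≈; tri>)
open import Relation.Binary.PropositionalEquality
  using (refl; sym; trans; cong; cong₂; subst; module ≡-Reasoning)
open import Relation.Nullary using (yes; no; contradiction)

euclidean-division : ∀ x d → 0ℤ < d → ∃₂ λ (q : ℤ) (r : ℕ) → + r < d × x ≡ + r + q * d
euclidean-division x +0       (+<+ ())
euclidean-division x +[1+ n ] _ =
  x /ℕ suc n , x %ℕ suc n , +<+ (n%ℕd<d x (suc n)) , a≡a%ℕn+[a/ℕn]*n x (suc n)

x≤y*x : ∀ {x y} → 0ℤ < y → 0ℤ ≤ x → x ≤ y * x
x≤y*x {x} {y} 0<y 0≤x = begin
  x       ≡⟨ ℤ.*-identityˡ x ⟨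
  1ℤ * x  ≤⟨ ℤ.*-monoʳ-≤-nonNeg x {{nonNegative 0≤x}} (ℤ.i<j⇒suc[i]≤j 0<y) ⟩
  y * x   ∎
  where open ℤ.≤-Reasoning

a≤s*a-t*b : ∀ {a b s t} → 0ℤ ≤ a → 0ℤ ≤ b → 0ℤ < s → t ≤ 0ℤ → a ≤ s * a - t * b
a≤s*a-t*b {a} {b} {s} {t} 0≤a 0≤b 0<s t≤0 = begin
  a              ≤⟨ x≤y*x 0<s 0≤a ⟩
  s * a          ≤⟨ ℤ.i≤i+j (s * a) (- (t * b)) {{nonNegative 0≤-tb}} ⟩
  s * a - t * b  ∎
  where
  open ℤ.≤-Reasoning
  0≤-tb : 0ℤ ≤ - (t * b)
  0≤-tb = ℤ.neg-mono-≤ (ℤ.*-monoʳ-≤-nonNeg b {{nonNegative 0≤b}} t≤0)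

x<y⇒x+z-y<z : ∀ {x y} z → x < y → x + z - y < z
x<y⇒x+z-y<z {x} {y} z x<y = begin-strict
  x + z - y  <⟨ ℤ.+-monoˡ-< (- y) (ℤ.+-monoˡ-< z x<y) ⟩
  y + z - y  ≡⟨ solve (y ∷ z ∷ []) ⟩
  z          ∎
  where open ℤ.≤-Reasoning

x≤1+y⇒x-z≤y : ∀ {x y z} → x ≤ 1ℤ + y → 0ℤ < z → x - z ≤ y
x≤1+y⇒x-z≤y {x} {y} {z} x≤1+y 0<z = begin
  x - z       ≤⟨ ℤ.+-monoʳ-≤ x (ℤ.neg-mono-≤ (ℤ.i<j⇒suc[i]≤j 0<z)) ⟩
  x - 1ℤ      ≤⟨ ℤ.+-monoˡ-≤ -1ℤ x≤1+y ⟩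
  1ℤ + y - 1ℤ ≡⟨ solve (y ∷ []) ⟩
  y           ∎
  where open ℤ.≤-Reasoning

x≡y+z⇒x-z≡y : ∀ {x y z} → x ≡ y + z → x - z ≡ y
x≡y+z⇒x-z≡y {y = y} {z} refl = solve (y ∷ z ∷ [])

x-y≡z⇒x≡y+z : ∀ {x y z} → x - y ≡ z → x ≡ y + z
x-y≡z⇒x≡y+z {x} {y} refl = solve (x ∷ y ∷ [])

x-y≡z⇒y≡x-z : ∀ {x y z} → x - y ≡ z → y ≡ x - z
x-y≡z⇒y≡x-z {x} {y} refl = solve (x ∷ y ∷ [])

negᵍ : ℤ[i] → ℤ[i]
negᵍ (x + y i) = (- x) + (- y) i

[z+u]-z≡u : ∀ z u → (z +ᵍ u) -ᵍ z ≡ u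
[z+u]-z≡u (x + y i) (u + v i) = cong₂ _+_i (identity x u) (identity y v)
  where
  identity : ∀ p q → p + q - p ≡ q
  identity = solve-∀

[x-y]+[y-z]≡x-z : ∀ x y z → (x -ᵍ y) +ᵍ (y -ᵍ z) ≡ x -ᵍ z
[x-y]+[y-z]≡x-z (x₁ + x₂ i) (y₁ + y₂ i) (z₁ + z₂ i) = cong₂ _+_i (identity x₁ y₁ z₁) (identity x₂ y₂ z₂)
  where
  identity : ∀ p q r → (p - q) + (q - r) ≡ p - r
  identity = solve-∀

y-x≡negᵍ[x-y] : ∀ x y → y -ᵍ x ≡ negᵍ (x -ᵍ y)
y-x≡negᵍ[x-y] (x₁ + x₂ i) (y₁ + y₂ i) = cong₂ _+_i (identity x₁ y₁) (identity x₂ y₂)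
  where
  identity : ∀ p q → q - p ≡ - (p - q)
  identity = solve-∀

*ᵍ-distribʳ-+ᵍ : ∀ m p q → (p +ᵍ q) *ᵍ m ≡ p *ᵍ m +ᵍ q *ᵍ m
*ᵍ-distribʳ-+ᵍ (a + b i) (p₁ + p₂ i) (q₁ + q₂ i) = cong₂ _+_i (identityʳ a b p₁ p₂ q₁ q₂) (identityⁱ a b p₁ p₂ q₁ q₂)
  where
  identityʳ : ∀ a b p₁ p₂ q₁ q₂ → (p₁ + q₁) * a - (p₂ + q₂) * b ≡ (p₁ * a - p₂ * b) + (q₁ * a - q₂ * b)
  identityʳ = solve-∀
  identityⁱ : ∀ a b p₁ p₂ q₁ q₂ → (p₁ + q₁) * b + (p₂ + q₂) * a ≡ (p₁ * b + p₂ * a) + (q₁ * b + q₂ * a)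
  identityⁱ = solve-∀

negᵍ-*ᵍ : ∀ m q → negᵍ (q *ᵍ m) ≡ negᵍ q *ᵍ m
negᵍ-*ᵍ (a + b i) (s + t i) = cong₂ _+_i (identityʳ a b s t) (identityⁱ a b s t)
  where
  identityʳ : ∀ a b s t → - (s * a - t * b) ≡ - s * a - - t * b
  identityʳ = solve-∀
  identityⁱ : ∀ a b s t → - (s * b + t * a) ≡ - s * b + - t * a
  identityⁱ = solve-∀

modᵍ-refl : ∀ {m} z → z ≡ z [modᵍ m ]
modᵍ-refl (x + y i) = 0ℤ + 0ℤ i , cong₂ _+_i (ℤ.+-inverseʳ x) (ℤ.+-inverseʳ y)

modᵍ-trans : ∀ {m} x y z → x ≡ y [modᵍ m ] → y ≡ z [modᵍ m ] → x ≡ z [modᵍ m ]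
modᵍ-trans {m} x y z (p , x-y≡pm) (q , y-z≡qm) = p +ᵍ q , (begin
  x -ᵍ z                ≡⟨ [x-y]+[y-z]≡x-z x y z ⟨
  (x -ᵍ y) +ᵍ (y -ᵍ z)  ≡⟨ cong₂ _+ᵍ_ x-y≡pm y-z≡qm ⟩
  p *ᵍ m +ᵍ q *ᵍ m      ≡⟨ *ᵍ-distribʳ-+ᵍ m p q ⟨
  (p +ᵍ q) *ᵍ m         ∎)
  where open ≡-Reasoning

modᵍ-translate : ∀ {m} z v q → v ≡ q *ᵍ m → (z +ᵍ v) ≡ z [modᵍ m ]
modᵍ-translate z v q v≡qm = q , trans ([z+u]-z≡u z v) v≡qm

w-w′≡qm⇒w′-w≡[-q]m : ∀ m w w′ q → w -ᵍ w′ ≡ q *ᵍ m → w′ -ᵍ w ≡ negᵍ q *ᵍ m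
w-w′≡qm⇒w′-w≡[-q]m m w w′ q w-w′≡qm = begin
  w′ -ᵍ w         ≡⟨ y-x≡negᵍ[x-y] w w′ ⟩
  negᵍ (w -ᵍ w′)  ≡⟨ cong negᵍ w-w′≡qm ⟩
  negᵍ (q *ᵍ m)   ≡⟨ negᵍ-*ᵍ m q ⟩
  negᵍ q *ᵍ m     ∎
  where open ≡-Reasoning

w-w′≡0m⇒w≡w′ : ∀ {m} w w′ → w -ᵍ w′ ≡ (0ℤ + 0ℤ i) *ᵍ m → w ≡ w′
w-w′≡0m⇒w≡w′ (x + y i) (x′ + y′ i) w-w′≡0 =
  cong₂ _+_i (ℤ.i-j≡0⇒i≡j x x′ (cong re w-w′≡0)) (ℤ.i-j≡0⇒i≡j y y′ (cong im w-w′≡0))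

LexPositive : ℤ[i] → Set
LexPositive (s + t i) = 0ℤ < s ⊎ (s ≡ 0ℤ × 0ℤ < t)

lexPositive-trichotomy : ∀ q → LexPositive q ⊎ q ≡ 0ℤ + 0ℤ i ⊎ LexPositive (negᵍ q)
lexPositive-trichotomy (s + t i) with ℤ.<-cmp 0ℤ s | ℤ.<-cmp 0ℤ t
... | tri< 0<s _ _  | _             = inj₁ (inj₁ 0<s)
... | tri> _ _ s<0  | _             = inj₂ (inj₂ (inj₁ (ℤ.neg-mono-< s<0)))
... | tri≈ _ refl _ | tri< 0<t _ _  = inj₁ (inj₂ (refl , 0<t))
... | tri≈ _ refl _ | tri≈ _ refl _ = inj₂ (inj₁ refl)
... | tri≈ _ refl _ | tri> _ _ t<0  = inj₂ (inj₂ (inj₂ (refl , ℤ.neg-mono-< t<0)))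

-i*ᵍ[a+bi] : ∀ a b → (0ℤ + -1ℤ i) *ᵍ (a + b i) ≡ b + (- a) i
-i*ᵍ[a+bi] a b = cong₂ _+_i (solve (a ∷ b ∷ [])) (solve (a ∷ b ∷ []))

-1*ᵍ[a+bi] : ∀ a b → (-1ℤ + 0ℤ i) *ᵍ (a + b i) ≡ (- a) + (- b) i
-1*ᵍ[a+bi] a b = cong₂ _+_i (solve (a ∷ b ∷ [])) (solve (a ∷ b ∷ []))

[-q]*ᵍ[a+bi] : ∀ a b q → ((- q) + 0ℤ i) *ᵍ (a + b i) ≡ (- (q * a)) + (- (q * b)) i
[-q]*ᵍ[a+bi] a b q = cong₂ _+_i (solve (a ∷ b ∷ q ∷ [])) (solve (a ∷ b ∷ q ∷ []))

[-q[b+ai]]*ᵍ[a+bi] : ∀ a b q → ((- (q * b)) + (- (q * a)) i) *ᵍ (a + b i) ≡ 0ℤ + (- (q * (a * a + b * b))) i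
[-q[b+ai]]*ᵍ[a+bi] a b q = cong₂ _+_i (solve (a ∷ b ∷ q ∷ [])) (solve (a ∷ b ∷ q ∷ []))

module Tiling (a b : ℤ) (0≤b : 0ℤ ≤ b) (b<a : b < a) where

  private instance
    b-nonNegative : NonNegative b
    b-nonNegative = nonNegative 0≤b

  0<a : 0ℤ < a
  0<a = ℤ.≤-<-trans 0≤b b<a

  0≤a : 0ℤ ≤ a
  0≤a = ℤ.<⇒≤ 0<a

  m : ℤ[i]
  m = a + b i

  Region : ℤ[i] → Set
  Region = InS∪T a b

  region-box : ∀ {x y} → Region (x + y i) → (0ℤ ≤ x × x < a) × (- b ≤ y × y < a)
  region-box (inj₁ (0≤x<a , (0≤y , y<a)))        = 0≤x<a , (ℤ.≤-trans (ℤ.neg-mono-≤ 0≤b) 0≤y , y<a)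
  region-box (inj₂ ((0≤x , x<b) , (-b≤y , y<0))) = (0≤x , ℤ.<-trans x<b b<a) , (-b≤y , ℤ.<-trans y<0 0<a)

  shift-down : ∀ z → (z +ᵍ (b + (- a) i)) ≡ z [modᵍ m ]
  shift-down z = modᵍ-translate z _ (0ℤ + -1ℤ i) (sym (-i*ᵍ[a+bi] a b))

  shift-left : ∀ z → (z +ᵍ ((- a) + (- b) i)) ≡ z [modᵍ m ]
  shift-left z = modᵍ-translate z _ (-1ℤ + 0ℤ i) (sym (-1*ᵍ[a+bi] a b))

  record Representative (z : ℤ[i]) : Set where
    constructor representative
    field
      point     : ℤ[i]
      region    : Region point
      congruent : point ≡ z [modᵍ m ]

  representative-resp : ∀ {w z} → w ≡ z [modᵍ m ] → Representative w → Representative z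
  representative-resp {w} {z} w≡z (representative v v∈R v≡w) =
    representative v v∈R (modᵍ-trans v w z v≡w w≡z)

  Floor : ℤ → ℤ → Set
  Floor r y = 0ℤ ≤ y ⊎ (r < b × - b ≤ y)

  floor⇒region : ∀ {r y} → 0ℤ ≤ r → r < a → y < a → Floor r y → Region (r + y i)
  floor⇒region 0≤r r<a y<a (inj₁ 0≤y) = inj₁ ((0≤r , r<a) , (0≤y , y<a))
  floor⇒region {y = y} 0≤r r<a y<a (inj₂ (r<b , -b≤y)) with 0ℤ ℤ.≤? y
  ... | yes 0≤y = inj₁ ((0≤r , r<a) , (0≤y , y<a))
  ... | no 0≰y  = inj₂ ((0≤r , r<b) , (-b≤y , ℤ.≰⇒> 0≰y))

  step-down : ∀ {r y} → 0ℤ ≤ r → r < a → a ≤ y →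
              ∃₂ λ r′ y′ → (0ℤ ≤ r′ × r′ < a) × Floor r′ y′ × y′ ≤ y - a × (r′ + y′ i) ≡ (r + y i) [modᵍ m ]
  step-down {r} {y} 0≤r r<a a≤y with r + b ℤ.<? a
  ... | yes r+b<a =
    r + b , y - a , (ℤ.+-mono-≤ 0≤r 0≤b , r+b<a) , inj₁ (ℤ.i≤j⇒0≤j-i a≤y) , ℤ.≤-refl , shift-down (r + y i)
  ... | no r+b≮a =
    r + b - a , y - a - b , (ℤ.i≤j⇒0≤j-i (ℤ.≮⇒≥ r+b≮a) , ℤ.<-trans r+b-a<b b<a) , inj₂ (r+b-a<b , -b≤y-a-b) ,
    ℤ.i-j≤i (y - a) b ,
    modᵍ-trans (((r + b) + (y - a) i) +ᵍ ((- a) + (- b) i)) ((r + b) + (y - a) i) (r + y i)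
      (shift-left ((r + b) + (y - a) i)) (shift-down (r + y i))
    where
    r+b-a<b : r + b - a < b
    r+b-a<b = x<y⇒x+z-y<z b r<a
    -b≤y-a-b : - b ≤ y - a - b
    -b≤y-a-b = ℤ.i≤j+i (- b) (y - a) {{nonNegative (ℤ.i≤j⇒0≤j-i a≤y)}}

  descend : ∀ n {r y} → 0ℤ ≤ r → r < a → Floor r y → y ≤ + n → Representative (r + y i)
  descend n {r} {y} 0≤r r<a floor y≤n with y ℤ.<? a
  ... | yes y<a = representative (r + y i) (floor⇒region 0≤r r<a y<a floor) (modᵍ-refl (r + y i))
  descend zero    _ _ _ y≤0 | no y≮a = contradiction (ℤ.≤-<-trans y≤0 0<a) y≮a
  descend (suc n) 0≤r r<a _ y≤1+n | no y≮a with step-down 0≤r r<a (ℤ.≮⇒≥ y≮a)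
  ... | _ , _ , (0≤r′ , r′<a) , floor′ , y′≤y-a , w′≡w =
    representative-resp w′≡w
      (descend n 0≤r′ r′<a floor′ (ℤ.≤-trans y′≤y-a (x≤1+y⇒x-z≤y {y = + n} y≤1+n 0<a)))

  norm-positive : 0ℤ < a * a + b * b
  norm-positive = ℤ.+-mono-<-≤ (ℤ.<-≤-trans 0<a (x≤y*x 0<a 0≤a)) (ℤ.*-monoʳ-≤-nonNeg b 0≤b)

  reduce-re : ∀ z → ∃₂ λ r y → 0ℤ ≤ r × r < a × (r + y i) ≡ z [modᵍ m ]
  reduce-re (x + y i) with euclidean-division x a 0<a
  ... | q , r , r<a , x≡r+qa =
    + r , y - q * b , +≤+ z≤n , r<a ,
    subst (_≡ (x + y i) [modᵍ m ]) translate≡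
      (modᵍ-translate (x + y i) _ ((- q) + 0ℤ i) (sym ([-q]*ᵍ[a+bi] a b q)))
    where
    translate≡ : (x + y i) +ᵍ ((- (q * a)) + (- (q * b)) i) ≡ (+ r) + (y - q * b) i
    translate≡ = cong (_+ (y - q * b) i) (x≡y+z⇒x-z≡y x≡r+qa)

  reduce-im : ∀ x y → ∃ λ n → (x + (+ n) i) ≡ (x + y i) [modᵍ m ]
  reduce-im x y with euclidean-division y (a * a + b * b) norm-positive
  ... | q , n , _ , y≡n+qN =
    n , subst (_≡ (x + y i) [modᵍ m ]) translate≡
          (modᵍ-translate (x + y i) _ ((- (q * b)) + (- (q * a)) i) (sym ([-q[b+ai]]*ᵍ[a+bi] a b q)))
    where
    translate≡ : (x + y i) +ᵍ (0ℤ + (- (q * (a * a + b * b))) i) ≡ x + (+ n) i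
    translate≡ = cong₂ _+_i (ℤ.+-identityʳ x) (x≡y+z⇒x-z≡y y≡n+qN)

  every-point-has-representative : ∀ z → Representative z
  every-point-has-representative z =
    let r , y , 0≤r , r<a , [r+yi]≡z = reduce-re z
        n , [r+ni]≡[r+yi] = reduce-im r y
    in representative-resp (modᵍ-trans (r + (+ n) i) (r + y i) z [r+ni]≡[r+yi] [r+yi]≡z)
         (descend n 0≤r r<a (inj₁ (+≤+ z≤n)) ℤ.≤-refl)

  re-difference<a : ∀ {x y x′ y′} → Region (x + y i) → Region (x′ + y′ i) → x - x′ < a
  re-difference<a {x} {x′ = x′} w∈R w′∈R with region-box w∈R | region-box w′∈R
  ... | (_ , x<a) , _ | (0≤x′ , _) , _ = ℤ.≤-<-trans (ℤ.i-j≤i x x′ {{nonNegative 0≤x′}}) x<a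

  im-difference<b+a : ∀ {x y x′ y′} → Region (x + y i) → Region (x′ + y′ i) → y - y′ < b + a
  im-difference<b+a {y = y} {y′ = y′} w∈R w′∈R with region-box w∈R | region-box w′∈R
  ... | _ , (_ , y<a) | _ , (-b≤y′ , _) = begin-strict
    y - y′   <⟨ ℤ.+-mono-<-≤ y<a (ℤ.neg-mono-≤ -b≤y′) ⟩
    a - - b  ≡⟨ solve (a ∷ b ∷ []) ⟩
    b + a    ∎
    where open ℤ.≤-Reasoning

  no-vertical-difference : ∀ {x y x′ y′ t} → Region (x + y i) → Region (x′ + y′ i) → 0ℤ < t →
                           x - x′ ≡ 0ℤ * a - t * b → y - y′ ≡ 0ℤ * b + t * a → ⊥
  no-vertical-difference {y = y} {y′ = y′} {t} w∈R (inj₁ (_ , (0≤y′ , _))) 0<t _ y-y′≡ta =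
    ℤ.<⇒≱ y′<0 0≤y′
    where
    open ℤ.≤-Reasoning
    y<a : y < a
    y<a = proj₂ (proj₂ (region-box w∈R))
    y′<0 : y′ < 0ℤ
    y′<0 = begin-strict
      y′                    ≡⟨ x-y≡z⇒y≡x-z {x = y} y-y′≡ta ⟩
      y - (0ℤ * b + t * a)  ≡⟨ cong (λ u → y - u) (ℤ.+-identityˡ (t * a)) ⟩
      y - t * a             ≤⟨ ℤ.+-monoʳ-≤ y (ℤ.neg-mono-≤ (x≤y*x 0<t 0≤a)) ⟩
      y - a                 <⟨ ℤ.+-monoˡ-< (- a) y<a ⟩
      a - a                 ≡⟨ ℤ.+-inverseʳ a ⟩
      0ℤ                    ∎
  no-vertical-difference {x} {x′ = x′} {t = t} w∈R (inj₂ ((_ , x′<b) , _)) 0<t x-x′≡-tb _ =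
    ℤ.<⇒≱ x<0 (proj₁ (proj₁ (region-box w∈R)))
    where
    open ℤ.≤-Reasoning
    x<0 : x < 0ℤ
    x<0 = begin-strict
      x                     ≡⟨ x-y≡z⇒x≡y+z x-x′≡-tb ⟩
      x′ + (0ℤ * a - t * b) ≡⟨ cong (λ u → x′ + u) (ℤ.+-identityˡ (- (t * b))) ⟩
      x′ - t * b            ≤⟨ ℤ.+-monoʳ-≤ x′ (ℤ.neg-mono-≤ (x≤y*x 0<t 0≤b)) ⟩
      x′ - b                <⟨ ℤ.+-monoˡ-< (- b) x′<b ⟩
      b - b                 ≡⟨ ℤ.+-inverseʳ b ⟩
      0ℤ                    ∎

  no-lexPositive-difference : ∀ w w′ q → Region w → Region w′ → w -ᵍ w′ ≡ q *ᵍ m → LexPositive q → ⊥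
  no-lexPositive-difference (x + y i) (x′ + y′ i) (s + t i) w∈R w′∈R w-w′≡qm (inj₁ 0<s)
    with t ℤ.≤? 0ℤ
  ... | yes t≤0 = ℤ.<⇒≱ (re-difference<a w∈R w′∈R) (begin
    a              ≤⟨ a≤s*a-t*b 0≤a 0≤b 0<s t≤0 ⟩
    s * a - t * b  ≡⟨ cong re w-w′≡qm ⟨
    x - x′         ∎)
    where open ℤ.≤-Reasoning
  ... | no t≰0 = ℤ.<⇒≱ (im-difference<b+a w∈R w′∈R) (begin
    b + a          ≤⟨ ℤ.+-mono-≤ (x≤y*x 0<s 0≤b) (x≤y*x (ℤ.≰⇒> t≰0) 0≤a) ⟩
    s * b + t * a  ≡⟨ cong im w-w′≡qm ⟨
    y - y′         ∎)
    where open ℤ.≤-Reasoning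
  no-lexPositive-difference (x + y i) (x′ + y′ i) (_ + t i) w∈R w′∈R w-w′≡qm (inj₂ (refl , 0<t)) =
    no-vertical-difference w∈R w′∈R 0<t (cong re w-w′≡qm) (cong im w-w′≡qm)

  representative-unique : ∀ w w′ → Region w → Region w′ → w ≡ w′ [modᵍ m ] → w ≡ w′
  representative-unique w w′ w∈R w′∈R (q , w-w′≡qm) with lexPositive-trichotomy q
  ... | inj₁ q>0         = ⊥-elim (no-lexPositive-difference w w′ q w∈R w′∈R w-w′≡qm q>0)
  ... | inj₂ (inj₁ refl) = w-w′≡0m⇒w≡w′ {m} w w′ w-w′≡qm
  ... | inj₂ (inj₂ -q>0) = ⊥-elim (no-lexPositive-difference w′ w (negᵍ q) w′∈R w∈R (w-w′≡qm⇒w′-w≡[-q]m m w w′ q w-w′≡qm) -q>0)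

mainTheorem12 : (a b : ℤ) → 0ℤ ≤ b → b < a →
    ((z : ℤ[i]) → ∃ λ w → InS∪T a b w × w ≡ z [modᵍ (a + b i) ])
    × ((w w′ : ℤ[i]) → InS∪T a b w → InS∪T a b w′ → w ≡ w′ [modᵍ (a + b i) ] → w ≡ w′)
mainTheorem12 a b 0≤b b<a = existence , representative-unique
  where
  open Tiling a b 0≤b b<a
  existence : (z : ℤ[i]) → ∃ λ w → InS∪T a b w × w ≡ z [modᵍ (a + b i) ]
  existence z = let representative w w∈R w≡z = every-point-has-representative z in w , w∈R , w≡z
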